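{- At any time during the execution of DLM, and for every element $z$, we have $\Phi_z\ge0$ and $\Psi_z\ge0$.
   Context: Online Min-Sum Set Cover with requests of cardinality at most $r$, over a universe $\mathcal U$ of $n$ elements. Lists are permutations $\mathcal U\to\{1,\dots,n\}$. Algorithm DLM. Every element $z$ has a budget $b(z)$, initially $0$. The operation fetch$(z)$ moves $z$ to position 1 by $\pi(z)-1$ adjacent swaps, so every element that preceded $z$ moves back by one position, and then sets $b(z)\gets0$. On a request $R$ with $|R|=s$, let $x\in R$ be the element of $R$ with the smallest current position and let $\ell=\pi(x)$. DLM pays $\ell$ and executes fetch$(x)$. For every $y\in R\setminus\{x\}$ it sets $b(y)\gets b(y)+\ell/s$. Then, while some $z$ has $b(z)\ge\pi(z)$, it executes fetch$(z)$. Potentials. Let $\pi$ be DLM's current permutation and $\pi^*$ the current permutation of an arbitrary offline algorithm Off. Write $\pi(z)=2^{p(z)}+q(z)$ with $p(z)\ge0$ an integer and $0\le q(z)\le 2^{p(z)}-1$, and analogously $\pi^*(z)=2^{p^*(z)}+q^*(z)$. Set $\alpha=2$, $\gamma=5r$, $\beta=7.5r+5$ and $\kappa=\lceil\log_2(6\beta)\rceil$. Define - $\Phi_z=\alpha\, b(z)$ if $p(z)\le p^*(z)+\kappa$, and $\Phi_z=\beta\,\pi(z)-\gamma\, b(z)$ if $p(z)\ge p^*(z)+\kappa+1$; - $\Psi_z=0$ if $p(z)\le p^*(z)+\kappa-1$, and $\Psi_z=2\beta\, q(z)$ if $p(z)\ge p^*(z)+\kappa$. -}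

module Defs where

open import Data.Nat as ℕ using (ℕ; zero; suc; _^_; _∸_)
open import Data.Nat.Logarithm using (⌊log₂_⌋; ⌈log₂_⌉)
open import Data.Integer using (+_)
open import Data.Rational as ℚ using (ℚ; _/_; 0ℚ)
open import Data.Fin using (Fin; toℕ)
open import Data.Fin.Permutation using (Permutation′; _⟨$⟩ʳ_)
open import Data.List using (List; []; _∷_; length)
open import Data.Bool.ListAction using (any)
open import Data.List.Membership.Propositional using (_∈_)
open import Data.List.Relation.Unary.Unique.Propositional using (Unique)
open import Data.Bool using (Bool; true; false; if_then_else_; _∧_; not)
open import Relation.Nullary using (does)
import Data.Fin as Fin

⟦_⟧ : ℕ → ℚ
⟦ k ⟧ = (+ k) / 1

-- A DLM state on the universe Fin n: positions (1-based) and budgets.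
record State (n : ℕ) : Set where
  constructor mkState
  field
    pos : Fin n → ℕ
    bud : Fin n → ℚ
open State public

posOf : ∀ {n} → Permutation′ n → Fin n → ℕ
posOf σ z = suc (toℕ (σ ⟨$⟩ʳ z))

initState : ∀ {n} → Permutation′ n → State n
initState σ = mkState (posOf σ) (λ _ → 0ℚ)

-- fetch(z): move z to the front; all elements that preceded z move back by one;
-- then reset b(z) to 0.
fetch : ∀ {n} → State n → Fin n → State n
fetch st z = mkState
  (λ w → if does (w Fin.≟ z) then 1
         else (if does (pos st w ℕ.<? pos st z) then suc (pos st w) else pos st w))
  (λ w → if does (w Fin.≟ z) then 0ℚ else bud st w)

-- ℓ / s where s = |R| (0 for the empty list, which never occurs)
share : ∀ {n} → ℕ → List (Fin n) → ℚ
share ℓ [] = 0ℚ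
share ℓ (a ∷ R) = (+ ℓ) / suc (length R)

inList : ∀ {n} → Fin n → List (Fin n) → Bool
inList y R = any (λ a → does (a Fin.≟ y)) R

-- Serving request R whose front-most element is x: fetch(x), then
-- b(y) += ℓ/s for every y ∈ R \ {x}, where ℓ = π(x) before the fetch.
serve : ∀ {n} → State n → List (Fin n) → Fin n → State n
serve st R x = mkState (pos st1)
  (λ y → if inList y R ∧ not (does (y Fin.≟ x)) then bud st1 y ℚ.+ share (pos st x) R
         else bud st1 y)
  where st1 = fetch st x

-- States occurring during an execution of DLM (with requests of cardinality
-- at most r) from the initial list π₀.  `serveStep` may only happen once the
-- while-loop has terminated (all budgets below positions); `fixStep` is one
-- iteration of the while-loop.
data Reachable {n : ℕ} (r : ℕ) (π₀ : Permutation′ n) : State n → Set where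
  initR : Reachable r π₀ (initState π₀)
  serveStep : ∀ {st} → Reachable r π₀ st →
    (∀ z → bud st z ℚ.< ⟦ pos st z ⟧) →
    (R : List (Fin n)) → Unique R → 1 ℕ.≤ length R → length R ℕ.≤ r →
    (x : Fin n) → x ∈ R → (∀ y → y ∈ R → pos st x ℕ.≤ pos st y) →
    Reachable r π₀ (serve st R x)
  fixStep : ∀ {st} → Reachable r π₀ st → (z : Fin n) →
    ⟦ pos st z ⟧ ℚ.≤ bud st z →
    Reachable r π₀ (fetch st z)

-- π(z) = 2^p(z) + q(z)
pPart : ℕ → ℕ
pPart m = ⌊log₂ m ⌋

qPart : ℕ → ℕ
qPart m = m ∸ 2 ^ ⌊log₂ m ⌋

-- constants: α = 2, γ = 5r, β = 7.5r + 5 = (15r+10)/2, κ = ⌈log₂(6β)⌉ = ⌈log₂(45r+30)⌉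
αc : ℚ
αc = ⟦ 2 ⟧

γc : ℕ → ℚ
γc r = ⟦ 5 ℕ.* r ⟧

βc : ℕ → ℚ
βc r = (+ (15 ℕ.* r ℕ.+ 10)) / 2

κc : ℕ → ℕ
κc r = ⌈log₂ (45 ℕ.* r ℕ.+ 30) ⌉

-- Φ_z, given DLM state st and the offline permutation π*
Φ : ∀ {n} → ℕ → State n → Permutation′ n → Fin n → ℚ
Φ r st πs z =
  if pPart (pos st z) ℕ.≤ᵇ pPart (posOf πs z) ℕ.+ κc r
  then αc ℚ.* bud st z
  else βc r ℚ.* ⟦ pos st z ⟧ ℚ.- γc r ℚ.* bud st z

Ψ : ∀ {n} → ℕ → State n → Permutation′ n → Fin n → ℚ
Ψ r st πs z =
  if pPart (pos st z) ℕ.<ᵇ pPart (posOf πs z) ℕ.+ κc r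
  then 0ℚ
  else ⟦ 2 ⟧ ℚ.* βc r ℚ.* ⟦ qPart (pos st z) ⟧

{-# OPTIONS --safe #-}
-- Every budget stays in [0, 3π/2]. Fetching resets a budget, and otherwise positions only
-- grow, so the bound is at stake only when a request R credits y ∈ R ∖ {x} with ℓ/|R|.
-- Requests are served only after the while-loop has ended, so then b(y) < π(y); and
-- ℓ = π(x) ≤ π(y) together with |R| ≥ 2 gives ℓ/|R| ≤ π(y)/2. With b ≤ 3π/2 the second
-- branch of Φ is at least (β − 3γ/2)π = 5π ≥ 0; all other branches are products of
-- nonnegative numbers.
module Submission where

open import Defs
open import Data.Nat as ℕ using (ℕ; suc)
import Data.Nat.Properties as ℕₚ
open import Data.Nat.Tactic.RingSolver as ℕSolver using ()
open import Data.Integer as ℤ using (+_)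
import Data.Integer.Properties as ℤₚ
open import Data.Integer.Tactic.RingSolver as ℤSolver using ()
open import Data.Rational as ℚ using (ℚ; 0ℚ; _≤_; _<_; _+_; _*_; _-_; _/_; toℚᵘ)
import Data.Rational.Properties as ℚₚ
open import Data.Rational.Unnormalised as ℚᵘ using (mkℚᵘ; *≡*; *≤*)
  renaming (_≃_ to _≃ᵘ_)
import Data.Rational.Unnormalised.Properties as ℚᵘₚ
open import Algebra.Bundles using (CommutativeMonoid)
open import Algebra.Properties.CommutativeSemigroup
  (CommutativeMonoid.commutativeSemigroup ℚₚ.*-1-commutativeMonoid) using (x∙yz≈y∙xz)
open import Data.Fin as Fin using (Fin)
open import Data.Fin.Permutation using (Permutation′)
open import Data.List using (List; []; _∷_; length)
open import Data.List.Membership.Propositional using (_∈_)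
open import Data.List.Membership.Propositional.Properties using (∈-length)
open import Data.List.Relation.Unary.Any using (here; there)
open import Data.Bool using (T; not; _∧_; true; false)
open import Data.Bool.Properties using (T-∧; T-≡)
open import Data.Product using (_×_; _,_)
open import Function using (_∘_; case_of_)
open import Function.Bundles using (Equivalence)
open import Relation.Nullary using (yes; no; does; contradiction)
open import Relation.Nullary.Decidable using (dec-true; dec-false)
open import Relation.Binary.PropositionalEquality

private
  variable
    n : ℕ

toℚᵘ-/ : ∀ i d-1 → toℚᵘ (i / suc d-1) ≃ᵘ mkℚᵘ i d-1
toℚᵘ-/ i d-1 = ℚₚ.toℚᵘ-fromℚᵘ (mkℚᵘ i d-1)

0≤[+k]/d : ∀ k d .{{_ : ℕ.NonZero d}} → 0ℚ ≤ (+ k) / d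
0≤[+k]/d k d = ℚₚ.nonNegative⁻¹ _ {{ℚₚ.normalize-nonNeg k d}}

⟦⟧-mono-≤ : ∀ {m n} → m ℕ.≤ n → ⟦ m ⟧ ≤ ⟦ n ⟧
⟦⟧-mono-≤ {m} {n} m≤n = ℚₚ.toℚᵘ-cancel-≤ (begin
  toℚᵘ ⟦ m ⟧       ≃⟨ toℚᵘ-/ (+ m) 0 ⟩
  mkℚᵘ (+ m) 0     ≤⟨ *≤* (ℤₚ.*-monoʳ-≤-nonNeg (+ 1) (ℤ.+≤+ m≤n)) ⟩
  mkℚᵘ (+ n) 0     ≃⟨ toℚᵘ-/ (+ n) 0 ⟨
  toℚᵘ ⟦ n ⟧       ∎)
  where open ℚᵘₚ.≤-Reasoning

⟦⟧-homo-+ : ∀ m n → ⟦ m ℕ.+ n ⟧ ≡ ⟦ m ⟧ + ⟦ n ⟧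
⟦⟧-homo-+ m n = ℚₚ.toℚᵘ-injective (begin
  toℚᵘ ⟦ m ℕ.+ n ⟧                ≈⟨ toℚᵘ-/ (+ (m ℕ.+ n)) 0 ⟩
  mkℚᵘ (+ (m ℕ.+ n)) 0            ≈⟨ *≡* (trans (cong (ℤ._* + 1) (ℤₚ.pos-+ m n))
                                                  (unit-denominators (+ m) (+ n))) ⟩
  mkℚᵘ (+ m) 0 ℚᵘ.+ mkℚᵘ (+ n) 0  ≈⟨ ℚᵘₚ.+-cong (toℚᵘ-/ (+ m) 0) (toℚᵘ-/ (+ n) 0) ⟨
  toℚᵘ ⟦ m ⟧ ℚᵘ.+ toℚᵘ ⟦ n ⟧      ≈⟨ ℚₚ.toℚᵘ-homo-+ ⟦ m ⟧ ⟦ n ⟧ ⟨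
  toℚᵘ (⟦ m ⟧ + ⟦ n ⟧)            ∎)
  where
  open ℚᵘₚ.≃-Reasoning
  unit-denominators : ∀ a b → (a ℤ.+ b) ℤ.* + 1 ≡ (a ℤ.* + 1 ℤ.+ b ℤ.* + 1) ℤ.* + 1
  unit-denominators = ℤSolver.solve-∀

⟦⟧-homo-* : ∀ m n → ⟦ m ℕ.* n ⟧ ≡ ⟦ m ⟧ * ⟦ n ⟧
⟦⟧-homo-* m n = ℚₚ.toℚᵘ-injective (begin
  toℚᵘ ⟦ m ℕ.* n ⟧                ≈⟨ toℚᵘ-/ (+ (m ℕ.* n)) 0 ⟩
  mkℚᵘ (+ (m ℕ.* n)) 0            ≈⟨ *≡* (cong (ℤ._* + 1) (ℤₚ.pos-* m n)) ⟩
  mkℚᵘ (+ m) 0 ℚᵘ.* mkℚᵘ (+ n) 0  ≈⟨ ℚᵘₚ.*-cong (toℚᵘ-/ (+ m) 0) (toℚᵘ-/ (+ n) 0) ⟨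
  toℚᵘ ⟦ m ⟧ ℚᵘ.* toℚᵘ ⟦ n ⟧      ≈⟨ ℚₚ.toℚᵘ-homo-* ⟦ m ⟧ ⟦ n ⟧ ⟨
  toℚᵘ (⟦ m ⟧ * ⟦ n ⟧)            ∎)
  where open ℚᵘₚ.≃-Reasoning

⟦d⟧*[k/d]≡⟦k⟧ : ∀ k d-1 → ⟦ suc d-1 ⟧ * ((+ k) / suc d-1) ≡ ⟦ k ⟧
⟦d⟧*[k/d]≡⟦k⟧ k d-1 = ℚₚ.toℚᵘ-injective (begin
  toℚᵘ (⟦ d ⟧ * ((+ k) / d))           ≈⟨ ℚₚ.toℚᵘ-homo-* ⟦ d ⟧ ((+ k) / d) ⟩
  toℚᵘ ⟦ d ⟧ ℚᵘ.* toℚᵘ ((+ k) / d)     ≈⟨ ℚᵘₚ.*-cong (toℚᵘ-/ (+ d) 0) (toℚᵘ-/ (+ k) d-1) ⟩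
  mkℚᵘ (+ d) 0 ℚᵘ.* mkℚᵘ (+ k) d-1     ≈⟨ *≡* (cancel (+ d) (+ k)) ⟩
  mkℚᵘ (+ k) 0                         ≈⟨ toℚᵘ-/ (+ k) 0 ⟨
  toℚᵘ ⟦ k ⟧                           ∎)
  where
  d = suc d-1
  open ℚᵘₚ.≃-Reasoning
  cancel : ∀ a b → (a ℤ.* b) ℤ.* + 1 ≡ b ℤ.* (+ 1 ℤ.* a)
  cancel = ℤSolver.solve-∀

*-nonNeg : ∀ {p q} → 0ℚ ≤ p → 0ℚ ≤ q → 0ℚ ≤ p * q
*-nonNeg {p} {q} 0≤p 0≤q = ℚₚ.nonNegative⁻¹ (p * q)
  {{ℚₚ.nonNeg*nonNeg⇒nonNeg p {{ℚ.nonNegative 0≤p}} q {{ℚ.nonNegative 0≤q}}}}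

p≤q⇒0≤q-p : ∀ {p q} → p ≤ q → 0ℚ ≤ q - p
p≤q⇒0≤q-p {p} {q} p≤q = begin
  0ℚ           ≡⟨ ℚₚ.+-inverseʳ p ⟨
  p - p        ≤⟨ ℚₚ.+-monoˡ-≤ (ℚ.- p) p≤q ⟩
  q - p        ∎
  where open ℚₚ.≤-Reasoning

record BudgetBound (π : ℕ) (b : ℚ) : Set where
  constructor budgetBound
  field
    0≤b   : 0ℚ ≤ b
    2b≤3π : ⟦ 2 ⟧ * b ≤ ⟦ 3 ℕ.* π ⟧
open BudgetBound

zero-budgetBound : ∀ π → BudgetBound π 0ℚ
zero-budgetBound π = budgetBound ℚₚ.≤-refl (0≤[+k]/d (3 ℕ.* π) 1)

budgetBound-mono : ∀ {π π′ b} → π ℕ.≤ π′ → BudgetBound π b → BudgetBound π′ b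
budgetBound-mono π≤π′ (budgetBound 0≤b 2b≤3π) =
  budgetBound 0≤b (ℚₚ.≤-trans 2b≤3π (⟦⟧-mono-≤ (ℕₚ.*-monoʳ-≤ 3 π≤π′)))

budgetBound-+ : ∀ {π b s} → 0ℚ ≤ b → b ≤ ⟦ π ⟧ → 0ℚ ≤ s → ⟦ 2 ⟧ * s ≤ ⟦ π ⟧ →
  BudgetBound π (b + s)
budgetBound-+ {π} {b} {s} 0≤b b≤π 0≤s 2s≤π = budgetBound (ℚₚ.+-mono-≤ 0≤b 0≤s) (begin
  ⟦ 2 ⟧ * (b + s)              ≡⟨ ℚₚ.*-distribˡ-+ ⟦ 2 ⟧ b s ⟩
  ⟦ 2 ⟧ * b + ⟦ 2 ⟧ * s        ≤⟨ ℚₚ.+-mono-≤ (ℚₚ.*-monoˡ-≤-nonNeg ⟦ 2 ⟧ b≤π) 2s≤π ⟩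
  ⟦ 2 ⟧ * ⟦ π ⟧ + ⟦ π ⟧        ≡⟨ cong (_+ ⟦ π ⟧) (⟦⟧-homo-* 2 π) ⟨
  ⟦ 2 ℕ.* π ⟧ + ⟦ π ⟧          ≡⟨ ⟦⟧-homo-+ (2 ℕ.* π) π ⟨
  ⟦ 2 ℕ.* π ℕ.+ π ⟧            ≡⟨ cong ⟦_⟧ (ℕₚ.+-comm (2 ℕ.* π) π) ⟩
  ⟦ 3 ℕ.* π ⟧                  ∎)
  where open ℚₚ.≤-Reasoning

budgetBound⇒γb≤βπ : ∀ r {π b} → BudgetBound π b → γc r * b ≤ βc r * ⟦ π ⟧
budgetBound⇒γb≤βπ r {π} {b} (budgetBound _ 2b≤3π) = ℚₚ.*-cancelˡ-≤-pos ⟦ 2 ⟧ (begin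
  ⟦ 2 ⟧ * (γc r * b)            ≡⟨ x∙yz≈y∙xz ⟦ 2 ⟧ (γc r) b ⟩
  γc r * (⟦ 2 ⟧ * b)            ≤⟨ ℚₚ.*-monoˡ-≤-nonNeg (γc r) {{ℚₚ.normalize-nonNeg (5 ℕ.* r) 1}}
                                                        2b≤3π ⟩
  γc r * ⟦ 3 ℕ.* π ⟧            ≡⟨ ⟦⟧-homo-* (5 ℕ.* r) (3 ℕ.* π) ⟨
  ⟦ 5 ℕ.* r ℕ.* (3 ℕ.* π) ⟧     ≤⟨ ⟦⟧-mono-≤ 15rπ≤[15r+10]π ⟩
  ⟦ (15 ℕ.* r ℕ.+ 10) ℕ.* π ⟧   ≡⟨ ⟦⟧-homo-* (15 ℕ.* r ℕ.+ 10) π ⟩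
  ⟦ 15 ℕ.* r ℕ.+ 10 ⟧ * ⟦ π ⟧   ≡⟨ cong (_* ⟦ π ⟧) (⟦d⟧*[k/d]≡⟦k⟧ (15 ℕ.* r ℕ.+ 10) 1) ⟨
  ⟦ 2 ⟧ * βc r * ⟦ π ⟧          ≡⟨ ℚₚ.*-assoc ⟦ 2 ⟧ (βc r) ⟦ π ⟧ ⟩
  ⟦ 2 ⟧ * (βc r * ⟦ π ⟧)        ∎)
  where
  open ℚₚ.≤-Reasoning
  reassoc : ∀ r π → 5 ℕ.* r ℕ.* (3 ℕ.* π) ≡ 15 ℕ.* r ℕ.* π
  reassoc = ℕSolver.solve-∀
  15rπ≤[15r+10]π : 5 ℕ.* r ℕ.* (3 ℕ.* π) ℕ.≤ (15 ℕ.* r ℕ.+ 10) ℕ.* π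
  15rπ≤[15r+10]π = ℕₚ.≤-trans (ℕₚ.≤-reflexive (reassoc r π))
                              (ℕₚ.*-monoˡ-≤ π (ℕₚ.m≤m+n (15 ℕ.* r) 10))

share-nonNeg : ∀ ℓ (R : List (Fin n)) → 0ℚ ≤ share ℓ R
share-nonNeg ℓ []      = ℚₚ.≤-refl
share-nonNeg ℓ (_ ∷ R) = 0≤[+k]/d ℓ (suc (length R))

share-≤-half : ∀ ℓ (R : List (Fin n)) → 2 ℕ.≤ length R → ⟦ 2 ⟧ * share ℓ R ≤ ⟦ ℓ ⟧
share-≤-half ℓ (_ ∷ R) 2≤|R| = begin
  ⟦ 2 ⟧ * (+ ℓ / d)   ≤⟨ ℚₚ.*-monoʳ-≤-nonNeg (+ ℓ / d) {{ℚₚ.normalize-nonNeg ℓ d}}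
                                              (⟦⟧-mono-≤ 2≤|R|) ⟩
  ⟦ d ⟧ * (+ ℓ / d)   ≡⟨ ⟦d⟧*[k/d]≡⟦k⟧ ℓ (length R) ⟩
  ⟦ ℓ ⟧               ∎
  where
  d = suc (length R)
  open ℚₚ.≤-Reasoning

distinct-∈⇒2≤length : ∀ {x y : Fin n} {R} → x ∈ R → y ∈ R → y ≢ x → 2 ℕ.≤ length R
distinct-∈⇒2≤length (here refl) (here refl) y≢x = contradiction refl y≢x
distinct-∈⇒2≤length (here _)    (there y∈R) _   = ℕ.s≤s (∈-length y∈R)
distinct-∈⇒2≤length (there x∈R) _           _   = ℕ.s≤s (∈-length x∈R)

T-inList⇒∈ : ∀ {y : Fin n} R → T (inList y R) → y ∈ R
T-inList⇒∈ {y = y} (a ∷ R) t with a Fin.≟ y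
... | yes a≡y = here (sym a≡y)
... | no _    = there (T-inList⇒∈ R t)

credited⇒∈×≢ : ∀ {x y : Fin n} R → T (inList y R ∧ not (does (y Fin.≟ x))) → y ∈ R × y ≢ x
credited⇒∈×≢ {x = x} {y} R t =
  let y∈?R , y≢?x = Equivalence.to T-∧ t
  in  T-inList⇒∈ R y∈?R , λ y≡x → subst (T ∘ not) (dec-true (y Fin.≟ x) y≡x) y≢?x

BudgetsBounded : State n → Set
BudgetsBounded st = ∀ z → BudgetBound (pos st z) (bud st z)

module _ (st : State n) (z : Fin n) where

  fetch-pos-self : pos (fetch st z) z ≡ 1
  fetch-pos-self rewrite dec-true (z Fin.≟ z) refl = refl

  fetch-bud-self : bud (fetch st z) z ≡ 0ℚ
  fetch-bud-self rewrite dec-true (z Fin.≟ z) refl = refl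

  fetch-pos-other : ∀ {w} → w ≢ z → pos st w ℕ.≤ pos (fetch st z) w
  fetch-pos-other {w} w≢z rewrite dec-false (w Fin.≟ z) w≢z with pos st w ℕ.<ᵇ pos st z
  ... | true  = ℕₚ.n≤1+n (pos st w)
  ... | false = ℕₚ.≤-refl

  fetch-bud-other : ∀ {w} → w ≢ z → bud (fetch st z) w ≡ bud st w
  fetch-bud-other {w} w≢z rewrite dec-false (w Fin.≟ z) w≢z = refl

  fetch-preserves-budgetsBounded : BudgetsBounded st → BudgetsBounded (fetch st z)
  fetch-preserves-budgetsBounded bounded w = case w Fin.≟ z of λ where
    (yes refl) → subst₂ BudgetBound (sym fetch-pos-self) (sym fetch-bud-self) (zero-budgetBound 1)
    (no w≢z)   → subst (BudgetBound (pos (fetch st z) w)) (sym (fetch-bud-other w≢z))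
                   (budgetBound-mono (fetch-pos-other w≢z) (bounded w))

serve-preserves-budgetsBounded : ∀ {st : State n} → BudgetsBounded st →
  (∀ z → bud st z < ⟦ pos st z ⟧) →
  ∀ {R x} → x ∈ R → (∀ y → y ∈ R → pos st x ℕ.≤ pos st y) →
  BudgetsBounded (serve st R x)
serve-preserves-budgetsBounded {st = st} bounded settled {R} {x} x∈R x-first y
  with inList y R ∧ not (does (y Fin.≟ x)) in credited
... | false = fetch-preserves-budgetsBounded st x bounded y
... | true  = credited-bound (credited⇒∈×≢ R (Equivalence.from T-≡ credited))
  where
  ℓ = pos st x
  credited-bound : y ∈ R × y ≢ x →
    BudgetBound (pos (fetch st x) y) (bud (fetch st x) y + share ℓ R)
  credited-bound (y∈R , y≢x) =
    subst (BudgetBound (pos (fetch st x) y)) (cong (_+ share ℓ R) (sym (fetch-bud-other st x y≢x)))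
      (budgetBound-mono (fetch-pos-other st x y≢x)
        (budgetBound-+ (0≤b (bounded y)) (ℚₚ.<⇒≤ (settled y)) (share-nonNeg ℓ R) 2s≤π))
    where
    2s≤π : ⟦ 2 ⟧ * share ℓ R ≤ ⟦ pos st y ⟧
    2s≤π = ℚₚ.≤-trans (share-≤-half ℓ R (distinct-∈⇒2≤length x∈R y∈R y≢x))
                      (⟦⟧-mono-≤ (x-first y y∈R))

reachable⇒budgetsBounded : ∀ {r π₀} {st : State n} → Reachable r π₀ st → BudgetsBounded st
reachable⇒budgetsBounded {π₀ = π₀} initR z = zero-budgetBound (posOf π₀ z)
reachable⇒budgetsBounded (serveStep reach settled _ _ _ _ _ x∈R x-first) =
  serve-preserves-budgetsBounded (reachable⇒budgetsBounded reach) settled x∈R x-first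
reachable⇒budgetsBounded (fixStep reach z _) =
  fetch-preserves-budgetsBounded _ z (reachable⇒budgetsBounded reach)

lemma4 : ∀ {n : ℕ} (r : ℕ) (π₀ : Permutation′ n) (st : State n) →
    Reachable r π₀ st → (πs : Permutation′ n) → (z : Fin n) →
    (0ℚ ≤ Φ r st πs z) × (0ℚ ≤ Ψ r st πs z)
lemma4 r π₀ st reach πs z = Φ-nonNeg , Ψ-nonNeg
  where
  bound : BudgetBound (pos st z) (bud st z)
  bound = reachable⇒budgetsBounded reach z
  Φ-nonNeg : 0ℚ ≤ Φ r st πs z
  Φ-nonNeg with pPart (pos st z) ℕ.≤ᵇ pPart (posOf πs z) ℕ.+ κc r
  ... | true  = *-nonNeg (0≤[+k]/d 2 1) (0≤b bound)
  ... | false = p≤q⇒0≤q-p (budgetBound⇒γb≤βπ r bound)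
  Ψ-nonNeg : 0ℚ ≤ Ψ r st πs z
  Ψ-nonNeg with pPart (pos st z) ℕ.<ᵇ pPart (posOf πs z) ℕ.+ κc r
  ... | true  = ℚₚ.≤-refl
  ... | false = *-nonNeg (*-nonNeg (0≤[+k]/d 2 1) (0≤[+k]/d (15 ℕ.* r ℕ.+ 10) 2))
                         (0≤[+k]/d (qPart (pos st z)) 1)
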